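{- Let $r\geq 3$, $k$ with $r+1\geq k\geq 4$, and $n\geq r+1$ be integers, and let $H$ be a graph on $k$ vertices which contains a tree on $4$ vertices as a subgraph but does not contain a cycle on $3$ vertices. Then $\sigma(K_{r+1}-H,n)\geq (r-1)(2n-r)-2(n-r)$.
   Context: A sequence $\pi=(d_1,\dots,d_n)$ of non-increasing nonnegative integers is graphic if it is the degree sequence of a simple graph on $n$ vertices (a realization of $\pi$); $\sigma(\pi)=d_1+\cdots+d_n$. For a graph $F$, a graphic sequence is potentially $F$-graphical if some realization contains $F$ as a subgraph. $\sigma(F,n)$ denotes the minimum even integer $l$ such that every $n$-term graphic sequence $\pi$ with $\sigma(\pi)\geq l$ is potentially $F$-graphical. For a graph $H$ on at most $m$ vertices, regarded as a subgraph of $K_m$, $K_m-H$ is the graph obtained from the complete graph $K_m$ by deleting the edges of $H$. -}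

module Defs where

open import Data.Bool using (Bool; true; false; not; _∧_; _∨_; if_then_else_)
open import Data.Nat using (ℕ; zero; suc; _+_; _*_; _∸_; _≤_; _<_; _≥_; _≡ᵇ_; _%_)
open import Data.Fin using (Fin; toℕ) renaming (zero to fzero; suc to fsuc)
open import Data.Fin.Properties using (_≟_)
open import Data.List using (List; map; allFin)
open import Data.Nat.ListAction using (sum)
open import Data.Maybe using (Maybe; just; nothing) renaming (map to mmap)
open import Data.Product using (Σ; _×_; ∃; _,_)
open import Relation.Nullary using (¬_)
open import Relation.Nullary.Decidable using (⌊_⌋)
open import Relation.Binary.PropositionalEquality using (_≡_)
open import Function.Definitions using (Injective)
open import Data.Nat.Divisibility using (_∣_)

record Graph (n : ℕ) : Set where
  field
    adj   : Fin n → Fin n → Bool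
    sym   : ∀ i j → adj i j ≡ adj j i
    irrefl : ∀ i → adj i i ≡ false
open Graph public

_⊆ᴳ_ : ∀ {m n} → (Fin m → Fin m → Bool) → (Fin n → Fin n → Bool) → Set
_⊆ᴳ_ {m} {n} F G =
  Σ (Fin m → Fin n) λ f → Injective _≡_ _≡_ f × (∀ u v → F u v ≡ true → G (f u) (f v) ≡ true)

-- The cycle C_l on vertex set Fin l (i ~ i+1 mod l); meaningful for l ≥ 3.
cycleAdj : (l : ℕ) → Fin l → Fin l → Bool
cycleAdj zero () _
cycleAdj (suc l) i j =
  (toℕ j ≡ᵇ (suc (toℕ i) % suc l)) ∨ (toℕ i ≡ᵇ (suc (toℕ j) % suc l))

data Reach {n : ℕ} (G : Graph n) : Fin n → Fin n → Set where
  here : ∀ {u} → Reach G u u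
  step : ∀ {u v w} → adj G u v ≡ true → Reach G v w → Reach G u w

Connected : ∀ {n} → Graph n → Set
Connected G = ∀ u v → Reach G u v

Acyclic : ∀ {n} → Graph n → Set
Acyclic {n} G = ∀ l → 3 ≤ l → ¬ (cycleAdj l ⊆ᴳ adj G)

IsTree : ∀ {n} → Graph n → Set
IsTree G = Connected G × Acyclic G

ContainsTree4 : ∀ {k} → Graph k → Set
ContainsTree4 {k} H = Σ (Graph 4) λ T → IsTree T × (adj T ⊆ᴳ adj H)

ContainsC3 : ∀ {k} → Graph k → Set
ContainsC3 H = cycleAdj 3 ⊆ᴳ adj H

-- Vertex i of Fin m, viewed as a vertex of H on Fin k when toℕ i < k
-- (H is placed on the first k vertices of K_m).
restrict : (k : ℕ) {m : ℕ} → Fin m → Maybe (Fin k)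
restrict zero _ = nothing
restrict (suc k) fzero = just fzero
restrict (suc k) (fsuc i) = mmap fsuc (restrict k i)

liftAdj : ∀ {k} (m : ℕ) → Graph k → Fin m → Fin m → Bool
liftAdj {k} m H i j with restrict k i | restrict k j
... | just u | just v = adj H u v
... | _ | _ = false

KminusH : ∀ {k} (m : ℕ) → Graph k → Fin m → Fin m → Bool
KminusH m H i j = not ⌊ i ≟ j ⌋ ∧ not (liftAdj m H i j)

deg : ∀ {n} → Graph n → Fin n → ℕ
deg {n} G i = sum (map (λ j → if adj G i j then 1 else 0) (allFin n))

σ : ∀ {n} → (Fin n → ℕ) → ℕ
σ {n} d = sum (map d (allFin n))

NonIncreasing : ∀ {n} → (Fin n → ℕ) → Set
NonIncreasing d = ∀ i j → toℕ i ≤ toℕ j → d j ≤ d i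

Realizes : ∀ {n} → Graph n → (Fin n → ℕ) → Set
Realizes G d = ∀ i → deg G i ≡ d i

Graphic : ∀ {n} → (Fin n → ℕ) → Set
Graphic {n} d = NonIncreasing d × Σ (Graph n) λ G → Realizes G d

PotentiallyGraphical : ∀ {n m} → (Fin m → Fin m → Bool) → (Fin n → ℕ) → Set
PotentiallyGraphical {n} F d = Σ (Graph n) λ G → Realizes G d × (F ⊆ᴳ adj G)

Admissible : ∀ {m} → (Fin m → Fin m → Bool) → ℕ → ℕ → Set
Admissible F n l = ∀ (d : Fin n → ℕ) → Graphic d → σ d ≥ l → PotentiallyGraphical F d

-- σ(F,n) ≥ L : every even admissible l is at least L (σ(F,n) is the least such l).
σFn≥ : ∀ {m} → (Fin m → Fin m → Bool) → ℕ → ℕ → Set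
σFn≥ F n L = ∀ l → 2 ∣ l → Admissible F n l → L ≤ l

{-# OPTIONS --safe #-}
-- Put c = r − 2 and let π be the degree sequence of the complete split graph on n vertices:
-- a clique on c vertices joined to an independent set on the other n − c, so
-- π = ((n − 1)^c, c^(n − c)).  Every realization of π is this graph: a vertex of degree
-- n − 1 is adjacent to everything, so a vertex of degree c already sees the c clique vertices
-- and nothing else.  A copy of K_{r+1} − H in it has r + 1 = c + 3 vertices, hence three
-- outside the clique; they are pairwise non-adjacent, so the three pairs are edges of H, a
-- triangle.  Thus π is not potentially (K_{r+1} − H)-graphical for triangle-free H, and as
-- σ(π) is even with σ(π) + 2 = (r − 1)(2n − r) − 2(n − r), no even l below the bound is admissible.
module Submission where

open import Defs hiding (sym)
open import Data.Bool using (Bool; true; false; not; _∧_; _∨_; if_then_else_)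
open import Data.Bool.Properties using (∨-comm; ∧-zeroʳ; ¬-not; not-injective)
open import Data.Nat using (ℕ; zero; suc; _+_; _*_; _∸_; _≤_; _<_; _<ᵇ_; z≤n; s≤s; s≤s⁻¹; _≤?_; _<?_)
open import Data.Nat.Properties
  using ( ≤-refl; ≤-reflexive; ≤-trans; ≤-<-trans; <⇒≤; <⇒≤pred; <⇒≱; ≤⇒≯; ≮⇒≥; ≰⇒>
        ; m≤m+n; m≤n+m; m≤n⇒∃[o]m+o≡n; +-mono-≤; +-mono-≤-<; *-monoˡ-≤; *-cancelʳ-<
        ; +-comm; +-assoc; m+n∸m≡n )
open import Data.Nat.Divisibility using (_∣_; divides; n∣m*n; ∣m∣n⇒∣m+n)
open import Data.Nat.ListAction using (sum)
open import Data.Nat.Tactic.RingSolver using (solve)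
open import Data.Fin using (Fin; toℕ; zero; suc; punchIn; fromℕ<)
open import Data.Fin.Properties
  using ( _≟_; any?; injective⇒≤; fromℕ<-injective; toℕ-injective; toℕ<n; suc-injective
        ; punchIn-injective; punchInᵢ≢i )
open import Data.List using ([]; _∷_; tabulate)
open import Data.List.Properties using (map-tabulate)
open import Data.Maybe using (just; nothing)
open import Data.Product using (Σ; ∃; _×_; _,_)
open import Function using (_∘_; id)
open import Function.Definitions using (Injective)
open import Relation.Nullary using (¬_; yes; no; contradiction)
open import Relation.Nullary.Decidable using (⌊_⌋; dec-true; dec-false; isYes≗does; ⌊⌋-map′)
open import Relation.Binary.PropositionalEquality

indicator : Bool → ℕ
indicator b = if b then 1 else 0

count : ∀ {n} → (Fin n → Bool) → ℕ
count p = sum (tabulate (indicator ∘ p))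

_⊆ᵇ_ : ∀ {n} → (Fin n → Bool) → (Fin n → Bool) → Set
p ⊆ᵇ q = ∀ j → p j ≡ true → q j ≡ true

count-cong : ∀ {n} {p q : Fin n → Bool} → (∀ j → p j ≡ q j) → count p ≡ count q
count-cong {zero}  p≗q = refl
count-cong {suc n} p≗q = cong₂ (λ b m → indicator b + m) (p≗q zero) (count-cong (p≗q ∘ suc))

count-true : ∀ n → count {n} (λ _ → true) ≡ n
count-true zero    = refl
count-true (suc n) = cong suc (count-true n)

indicator-mono : ∀ {a b} → (a ≡ true → b ≡ true) → indicator a ≤ indicator b
indicator-mono {false} a⇒b = z≤n
indicator-mono {true}  a⇒b rewrite a⇒b refl = ≤-refl

count-mono : ∀ {n} {p q : Fin n → Bool} → p ⊆ᵇ q → count p ≤ count q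
count-mono {zero}  p⊆q = z≤n
count-mono {suc n} p⊆q = +-mono-≤ (indicator-mono (p⊆q zero)) (count-mono (p⊆q ∘ suc))

count-< : ∀ {n} {p q : Fin n → Bool} → p ⊆ᵇ q → ∀ j → q j ≡ true → p j ≡ false → count p < count q
count-< p⊆q zero    qj pj rewrite qj | pj = s≤s (count-mono (p⊆q ∘ suc))
count-< p⊆q (suc j) qj pj = +-mono-≤-< (indicator-mono (p⊆q zero)) (count-< (p⊆q ∘ suc) j qj pj)

⊆∧count≤⇒⊇ : ∀ {n} {p q : Fin n → Bool} → p ⊆ᵇ q → count q ≤ count p → q ⊆ᵇ p
⊆∧count≤⇒⊇ {p = p} p⊆q q≤p j qj with p j in pj
... | true  = refl
... | false = contradiction q≤p (<⇒≱ (count-< p⊆q j qj pj))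

sum-tabulate-<ᵇ : ∀ {n} c a b → c ≤ n →
  sum (tabulate {n = n} λ j → if toℕ j <ᵇ c then a else b) ≡ c * a + (n ∸ c) * b
sum-tabulate-<ᵇ {zero}  zero    a b z≤n       = refl
sum-tabulate-<ᵇ {suc n} zero    a b z≤n       = cong (b +_) (sum-tabulate-<ᵇ {n} zero a b z≤n)
sum-tabulate-<ᵇ {suc n} (suc c) a b (s≤s c≤n) =
  trans (cong (a +_) (sum-tabulate-<ᵇ c a b c≤n)) (sym (+-assoc a (c * a) _))

⌊≟⌋-refl : ∀ {n} (i : Fin n) → ⌊ i ≟ i ⌋ ≡ true
⌊≟⌋-refl i = trans (isYes≗does (i ≟ i)) (dec-true (i ≟ i) refl)

⌊≟⌋-≢ : ∀ {n} {i j : Fin n} → i ≢ j → ⌊ i ≟ j ⌋ ≡ false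
⌊≟⌋-≢ {i = i} {j} i≢j = trans (isYes≗does (i ≟ j)) (dec-false (i ≟ j) i≢j)

⌊≟⌋-sym : ∀ {n} (i j : Fin n) → ⌊ i ≟ j ⌋ ≡ ⌊ j ≟ i ⌋
⌊≟⌋-sym i j with i ≟ j
... | yes refl = sym (⌊≟⌋-refl i)
... | no  i≢j  = sym (⌊≟⌋-≢ (i≢j ∘ sym))

count-≢ : ∀ {n} (i : Fin n) → count (λ j → not ⌊ i ≟ j ⌋) ≡ n ∸ 1
count-≢ {suc n} zero    = count-true n
count-≢ {suc (suc n)} (suc i) =
  cong suc (trans (count-cong λ j → cong not (⌊⌋-map′ (cong suc) suc-injective (i ≟ j))) (count-≢ i))

count-<ᵇ : ∀ {n} c → c ≤ n → count {n} (λ j → toℕ j <ᵇ c) ≡ c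
count-<ᵇ {zero}  zero    z≤n     = refl
count-<ᵇ {suc n} zero    z≤n     = count-<ᵇ {n} zero z≤n
count-<ᵇ {suc n} (suc c) (s≤s c≤n) = cong suc (count-<ᵇ c c≤n)

∃-image-≥ : ∀ {m n} c (f : Fin m → Fin n) → Injective _≡_ _≡_ f → c < m → ∃ λ x → c ≤ toℕ (f x)
∃-image-≥ {m} c f f-inj c<m with any? (λ x → c ≤? toℕ (f x))
... | yes found = found
... | no  none  = contradiction (injective⇒≤ g-inj) (<⇒≱ c<m)
  where
  below : ∀ x → toℕ (f x) < c
  below x = ≰⇒> λ c≤fx → none (x , c≤fx)
  g : Fin m → Fin c
  g x = fromℕ< (below x)
  g-inj : Injective _≡_ _≡_ g
  g-inj {x} {y} gx≡gy = f-inj (toℕ-injective (fromℕ<-injective _ _ (below x) (below y) gx≡gy))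

_◃_ : ∀ {s m} → Fin (suc m) → (Fin s → Fin m) → Fin (suc s) → Fin (suc m)
(y ◃ e) zero    = y
(y ◃ e) (suc x) = punchIn y (e x)

◃-injective : ∀ {s m} (y : Fin (suc m)) {e : Fin s → Fin m} → Injective _≡_ _≡_ e → Injective _≡_ _≡_ (y ◃ e)
◃-injective y     e-inj {zero}  {zero}   _  = refl
◃-injective y {e} e-inj {zero}  {suc x′} eq = contradiction (sym eq) (punchInᵢ≢i y (e x′))
◃-injective y {e} e-inj {suc x} {zero}   eq = contradiction eq (punchInᵢ≢i y (e x))
◃-injective y     e-inj {suc x} {suc x′} eq = cong suc (e-inj (punchIn-injective y _ _ eq))

∃-injection-image-≥ : ∀ s {m n} c (f : Fin m → Fin n) → Injective _≡_ _≡_ f → s + c ≤ m →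
  Σ (Fin s → Fin m) λ e → Injective _≡_ _≡_ e × (∀ x → c ≤ toℕ (f (e x)))
∃-injection-image-≥ zero    c f f-inj _ = (λ ()) , (λ { {()} }) , λ ()
∃-injection-image-≥ (suc s) c f f-inj (s≤s s+c≤m)
  with y , c≤fy ← ∃-image-≥ c f f-inj (s≤s (≤-trans (m≤n+m c s) s+c≤m))
  with e , e-inj , c≤fe ← ∃-injection-image-≥ s c (f ∘ punchIn y) (punchIn-injective y _ _ ∘ f-inj) s+c≤m
  = y ◃ e , ◃-injective y e-inj , λ { zero → c≤fy ; (suc x) → c≤fe x }

deg≡count : ∀ {n} (G : Graph n) i → deg G i ≡ count (adj G i)
deg≡count G i = cong sum (map-tabulate id (indicator ∘ adj G i))

adj⇒≢ : ∀ {n} (G : Graph n) {i j} → adj G i j ≡ true → i ≢ j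
adj⇒≢ G {i} Gij refl = contradiction (trans (sym Gij) (irrefl G i)) λ ()

adj⊆≢ : ∀ {n} (G : Graph n) i → adj G i ⊆ᵇ (λ j → not ⌊ i ≟ j ⌋)
adj⊆≢ G i j Gij = cong not (⌊≟⌋-≢ (adj⇒≢ G Gij))

nonadjacency-reflected : ∀ {m n} {F : Fin m → Fin m → Bool} {G : Fin n → Fin n → Bool} (f : Fin m → Fin n) →
  (∀ u v → F u v ≡ true → G (f u) (f v) ≡ true) → ∀ {u v} → G (f u) (f v) ≡ false → F u v ≡ false
nonadjacency-reflected f f-hom {u} {v} ¬Gfufv =
  ¬-not λ Fuv → contradiction (trans (sym (f-hom u v Fuv)) ¬Gfufv) λ ()

complete⇒⊆ᴳ : ∀ {m k} {F : Fin m → Fin m → Bool} (H : Graph k) → (∀ u → F u u ≡ false) →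
  (t : Fin m → Fin k) → (∀ u v → u ≢ v → adj H (t u) (t v) ≡ true) → F ⊆ᴳ adj H
complete⇒⊆ᴳ {F = F} H F-irrefl t t-complete = t , t-inj , t-hom
  where
  t-inj : Injective _≡_ _≡_ t
  t-inj {u} {v} tu≡tv with u ≟ v
  ... | yes u≡v = u≡v
  ... | no  u≢v = contradiction tu≡tv (adj⇒≢ H (t-complete u v u≢v))
  t-hom : ∀ u v → F u v ≡ true → adj H (t u) (t v) ≡ true
  t-hom u v Fuv = t-complete u v λ { refl → contradiction (trans (sym Fuv) (F-irrefl u)) λ () }

triangle⇒C3 : ∀ {k} (H : Graph k) {a b c} →
  adj H a b ≡ true → adj H a c ≡ true → adj H b c ≡ true → ContainsC3 H
triangle⇒C3 H {a} {b} {c} ab ac bc = complete⇒⊆ᴳ H C3-irrefl t t-complete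
  where
  C3-irrefl : ∀ u → cycleAdj 3 u u ≡ false
  C3-irrefl zero             = refl
  C3-irrefl (suc zero)       = refl
  C3-irrefl (suc (suc zero)) = refl
  t : Fin 3 → Fin _
  t zero             = a
  t (suc zero)       = b
  t (suc (suc zero)) = c
  t-complete : ∀ u v → u ≢ v → adj H (t u) (t v) ≡ true
  t-complete zero             zero             u≢v = contradiction refl u≢v
  t-complete zero             (suc zero)       _   = ab
  t-complete zero             (suc (suc zero)) _   = ac
  t-complete (suc zero)       zero             _   = trans (Graph.sym H b a) ab
  t-complete (suc zero)       (suc zero)       u≢v = contradiction refl u≢v
  t-complete (suc zero)       (suc (suc zero)) _   = bc
  t-complete (suc (suc zero)) zero             _   = trans (Graph.sym H c a) ac
  t-complete (suc (suc zero)) (suc zero)       _   = trans (Graph.sym H c b) bc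
  t-complete (suc (suc zero)) (suc (suc zero)) u≢v = contradiction refl u≢v

HasIndependentSet : ∀ {m} → ℕ → (Fin m → Fin m → Bool) → Set
HasIndependentSet {m} s F = Σ (Fin s → Fin m) λ e → Injective _≡_ _≡_ e × (∀ u v → F (e u) (e v) ≡ false)

liftAdj-triangle⇒C3 : ∀ {k m} (H : Graph k) {x y z : Fin m} →
  liftAdj m H x y ≡ true → liftAdj m H x z ≡ true → liftAdj m H y z ≡ true → ContainsC3 H
liftAdj-triangle⇒C3 {k} H {x} {y} {z} xy xz yz with restrict k x | restrict k y | restrict k z
liftAdj-triangle⇒C3 H xy xz yz | just _  | just _  | just _  = triangle⇒C3 H xy xz yz
liftAdj-triangle⇒C3 H () xz yz | nothing | _       | _
liftAdj-triangle⇒C3 H () xz yz | just _  | nothing | _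
liftAdj-triangle⇒C3 H xy () yz | just _  | just _  | nothing

KminusH-nonadjacent⇒liftAdj : ∀ {k m} (H : Graph k) {x y : Fin m} →
  x ≢ y → KminusH m H x y ≡ false → liftAdj m H x y ≡ true
KminusH-nonadjacent⇒liftAdj {m = m} H {x} {y} x≢y ¬xy =
  not-injective (trans (cong (λ b → not b ∧ not (liftAdj m H x y)) (sym (⌊≟⌋-≢ x≢y))) ¬xy)

KminusH-independent3⇒C3 : ∀ {k m} (H : Graph k) → HasIndependentSet 3 (KminusH m H) → ContainsC3 H
KminusH-independent3⇒C3 H (e , e-inj , independent) =
  liftAdj-triangle⇒C3 H (H-adj zero (suc zero) λ ()) (H-adj zero (suc (suc zero)) λ ())
                        (H-adj (suc zero) (suc (suc zero)) λ ())
  where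
  H-adj : ∀ u v → u ≢ v → liftAdj _ H (e u) (e v) ≡ true
  H-adj u v u≢v = KminusH-nonadjacent⇒liftAdj H (u≢v ∘ e-inj) (independent u v)

∸-≡ : ∀ a b {d} → a ≡ b + d → a ∸ b ≡ d
∸-≡ _ b {d} refl = m+n∸m≡n b d

2∣n*[1+n] : ∀ n → 2 ∣ n * suc n
2∣n*[1+n] zero    = divides 0 refl
2∣n*[1+n] (suc n) = subst (2 ∣_) n[1+n]+[1+n]2≡[1+n][2+n] (∣m∣n⇒∣m+n (2∣n*[1+n] n) (n∣m*n (suc n)))
  where
  n[1+n]+[1+n]2≡[1+n][2+n] : n * suc n + suc n * 2 ≡ suc n * suc (suc n)
  n[1+n]+[1+n]2≡[1+n][2+n] = solve (n ∷ [])

even-<-+2⇒≤ : ∀ {m n} → 2 ∣ m → 2 ∣ n → m < n + 2 → m ≤ n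
even-<-+2⇒≤ (divides q refl) (divides h refl) q*2<h*2+2 =
  *-monoˡ-≤ 2 (s≤s⁻¹ (*-cancelʳ-< 2 q (suc h) (subst (q * 2 <_) (+-comm (h * 2) 2) q*2<h*2+2)))

[2+c+o]∸c≡2+o : ∀ c o → 2 + c + o ∸ c ≡ 2 + o
[2+c+o]∸c≡2+o c o = ∸-≡ (2 + c + o) c (solve (c ∷ o ∷ []))

splitSum : ℕ → ℕ → ℕ
splitSum n c = c * (n ∸ 1) + (n ∸ c) * c

bound≡splitSum+2 : ∀ c n → 2 + c ≤ n → suc c * (2 * n ∸ (2 + c)) ∸ 2 * (n ∸ (2 + c)) ≡ splitSum n c + 2
bound≡splitSum+2 c n 2+c≤n with o , refl ← m≤n⇒∃[o]m+o≡n 2+c≤n = begin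
    suc c * (2 * (2 + c + o) ∸ (2 + c)) ∸ 2 * (2 + c + o ∸ (2 + c))
  ≡⟨ cong₂ (λ a b → suc c * a ∸ 2 * b) (2[2+c+o]∸[2+c]≡2+c+2o c o) (m+n∸m≡n (2 + c) o) ⟩
    suc c * (2 + c + 2 * o) ∸ 2 * o
  ≡⟨ ∸-≡ (suc c * (2 + c + 2 * o)) (2 * o) (expand c o) ⟩
    c * suc (c + o) + (2 + o) * c + 2
  ≡⟨ cong (λ a → c * suc (c + o) + a * c + 2) ([2+c+o]∸c≡2+o c o) ⟨
    splitSum (2 + c + o) c + 2
  ∎
  where
  open ≡-Reasoning
  2[2+c+o]∸[2+c]≡2+c+2o : ∀ c o → 2 * (2 + c + o) ∸ (2 + c) ≡ 2 + c + 2 * o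
  2[2+c+o]∸[2+c]≡2+c+2o c o = ∸-≡ (2 * (2 + c + o)) (2 + c) (solve (c ∷ o ∷ []))
  expand : ∀ c o → suc c * (2 + c + 2 * o) ≡ 2 * o + (c * suc (c + o) + (2 + o) * c + 2)
  expand c o = solve (c ∷ o ∷ [])

2∣splitSum : ∀ c n → 2 + c ≤ n → 2 ∣ splitSum n c
2∣splitSum c n 2+c≤n with o , refl ← m≤n⇒∃[o]m+o≡n 2+c≤n rewrite [2+c+o]∸c≡2+o c o =
  subst (2 ∣_) (regroup c o) (∣m∣n⇒∣m+n (2∣n*[1+n] c) (n∣m*n (c + c * o)))
  where
  regroup : ∀ c o → c * suc c + (c + c * o) * 2 ≡ c * suc (c + o) + (2 + o) * c
  regroup c o = solve (c ∷ o ∷ [])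

module CompleteSplit (n c : ℕ) where

  inClique : Fin n → Bool
  inClique i = toℕ i <ᵇ c

  ≥⇒∉clique : ∀ {i} → c ≤ toℕ i → inClique i ≡ false
  ≥⇒∉clique {i} c≤i = dec-false (toℕ i <? c) (≤⇒≯ c≤i)

  ∉clique⇒≥ : ∀ {i} → inClique i ≡ false → c ≤ toℕ i
  ∉clique⇒≥ {i} i∉K = ≮⇒≥ λ i<c → contradiction (trans (sym (dec-true (toℕ i <? c) i<c)) i∉K) λ ()

  ∉clique∧∈clique⇒≢ : ∀ {i j} → inClique i ≡ false → inClique j ≡ true → i ≢ j
  ∉clique∧∈clique⇒≢ i∉K j∈K refl = contradiction (trans (sym i∉K) j∈K) λ ()

  adjacency : Fin n → Fin n → Bool
  adjacency i j = (inClique i ∨ inClique j) ∧ not ⌊ i ≟ j ⌋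

  graph : Graph n
  graph = record
    { adj    = adjacency
    ; sym    = λ i j → cong₂ (λ a b → a ∧ not b) (∨-comm (inClique i) (inClique j)) (⌊≟⌋-sym i j)
    ; irrefl = λ i → trans (cong (λ b → (inClique i ∨ inClique i) ∧ not b) (⌊≟⌋-refl i)) (∧-zeroʳ _)
    }

  adjacency-∈clique : ∀ {i} → inClique i ≡ true → ∀ j → adjacency i j ≡ not ⌊ i ≟ j ⌋
  adjacency-∈clique i∈K j rewrite i∈K = refl

  adjacency-∉clique : ∀ {i} → inClique i ≡ false → ∀ j → adjacency i j ≡ inClique j
  adjacency-∉clique i∉K j rewrite i∉K with inClique j in j∈K?
  ... | false = refl
  ... | true  = cong not (⌊≟⌋-≢ (∉clique∧∈clique⇒≢ i∉K j∈K?))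

  degrees : Fin n → ℕ
  degrees i = if inClique i then n ∸ 1 else c

  count-adjacency : ∀ i → count (adjacency i) ≡ degrees i
  count-adjacency i = by-membership (inClique i) refl
    where
    -- `with inClique i` would also abstract it inside `adjacency i`.
    by-membership : ∀ b → inClique i ≡ b → count (adjacency i) ≡ (if b then n ∸ 1 else c)
    by-membership true  i∈K = trans (count-cong (adjacency-∈clique i∈K)) (count-≢ i)
    by-membership false i∉K = trans (count-cong (adjacency-∉clique i∉K)) (count-<ᵇ c c≤n)
      where
      c≤n : c ≤ n
      c≤n = <⇒≤ (≤-<-trans (∉clique⇒≥ i∉K) (toℕ<n i))

  graph-realizes : Realizes graph degrees
  graph-realizes i = trans (deg≡count graph i) (count-adjacency i)

  degrees-nonIncreasing : NonIncreasing degrees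
  degrees-nonIncreasing i j i≤j with inClique i in i∈K? | inClique j in j∈K?
  ... | true  | true  = ≤-refl
  ... | false | false = ≤-refl
  ... | true  | false = <⇒≤pred (≤-<-trans (∉clique⇒≥ j∈K?) (toℕ<n j))
  ... | false | true  =
    contradiction (trans (sym j∈K?) (≥⇒∉clique (≤-trans (∉clique⇒≥ i∈K?) i≤j))) λ ()

  degrees-graphic : Graphic degrees
  degrees-graphic = degrees-nonIncreasing , graph , graph-realizes

  σ-degrees : c ≤ n → σ degrees ≡ splitSum n c
  σ-degrees c≤n = trans (cong sum (map-tabulate id degrees)) (sum-tabulate-<ᵇ c (n ∸ 1) c c≤n)

  module _ (G : Graph n) (realizes : Realizes G degrees) where

    count-adjacency≡count-adj : ∀ i → count (adjacency i) ≡ count (adj G i)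
    count-adjacency≡count-adj i = trans (count-adjacency i) (trans (sym (realizes i)) (deg≡count G i))

    ∈clique⇒universal : ∀ {i} → inClique i ≡ true → (λ j → not ⌊ i ≟ j ⌋) ⊆ᵇ adj G i
    ∈clique⇒universal {i} i∈K = ⊆∧count≤⇒⊇ (adj⊆≢ G i) (≤-reflexive (begin
      count (λ j → not ⌊ i ≟ j ⌋) ≡⟨ count-cong (adjacency-∈clique i∈K) ⟨
      count (adjacency i)         ≡⟨ count-adjacency≡count-adj i ⟩
      count (adj G i)             ∎))
      where open ≡-Reasoning

    ∉clique⇒adj⊆clique : ∀ {i} → inClique i ≡ false → adj G i ⊆ᵇ inClique
    ∉clique⇒adj⊆clique {i} i∉K = ⊆∧count≤⇒⊇ clique⊆adj (≤-reflexive (begin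
      count (adj G i)     ≡⟨ count-adjacency≡count-adj i ⟨
      count (adjacency i) ≡⟨ count-cong (adjacency-∉clique i∉K) ⟩
      count inClique      ∎))
      where
      open ≡-Reasoning
      clique⊆adj : inClique ⊆ᵇ adj G i
      clique⊆adj j j∈K = trans (Graph.sym G i j)
        (∈clique⇒universal j∈K i (cong not (⌊≟⌋-≢ (∉clique∧∈clique⇒≢ i∉K j∈K ∘ sym))))

    ∉clique⇒nonadjacent : ∀ {i j} → inClique i ≡ false → inClique j ≡ false → adj G i j ≡ false
    ∉clique⇒nonadjacent {i} {j} i∉K j∉K =
      ¬-not λ Gij → contradiction (trans (sym j∉K) (∉clique⇒adj⊆clique i∉K j Gij)) λ ()

  potentially⇒independent : ∀ {m} {F : Fin m → Fin m → Bool} s → s + c ≤ m →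
    PotentiallyGraphical F degrees → HasIndependentSet s F
  potentially⇒independent s s+c≤m (G , realizes , f , f-inj , f-hom) =
    let e , e-inj , c≤fe = ∃-injection-image-≥ s c f f-inj s+c≤m in
    e , e-inj , λ u v → nonadjacency-reflected {G = adj G} f f-hom
      (∉clique⇒nonadjacent G realizes (≥⇒∉clique (c≤fe u)) (≥⇒∉clique (c≤fe v)))

lemma3p4 : (r k n : ℕ) → 3 ≤ r → 4 ≤ k → k ≤ r + 1 → r + 1 ≤ n →
    (H : Graph k) → ContainsTree4 H → ¬ ContainsC3 H →
    σFn≥ (KminusH (r + 1) H) n ((r ∸ 1) * (2 * n ∸ r) ∸ 2 * (n ∸ r))
lemma3p4 (suc zero)    _ _ (s≤s ()) _ _ _ _ _ _ _ _
lemma3p4 (suc (suc c)) _ n _ _ _ r+1≤n H _ C3-free l 2∣l admissible =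
  ≮⇒≥ λ l<bound → C3-free (KminusH-independent3⇒C3 H
    (potentially⇒independent 3 3+c≤r+1 (admissible degrees degrees-graphic (l≤σ l<bound))))
  where
  open CompleteSplit n c
  3+c≤r+1 : 3 + c ≤ suc (suc c) + 1
  3+c≤r+1 = ≤-reflexive (cong (2 +_) (+-comm 1 c))
  2+c≤n : 2 + c ≤ n
  2+c≤n = ≤-trans (m≤m+n (2 + c) 1) r+1≤n
  σ≡splitSum : σ degrees ≡ splitSum n c
  σ≡splitSum = σ-degrees (≤-trans (m≤n+m c 2) 2+c≤n)
  l≤σ : l < suc c * (2 * n ∸ (2 + c)) ∸ 2 * (n ∸ (2 + c)) → l ≤ σ degrees
  l≤σ l<bound = even-<-+2⇒≤ 2∣l (subst (2 ∣_) (sym σ≡splitSum) (2∣splitSum c n 2+c≤n))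
    (subst (l <_) (trans (bound≡splitSum+2 c n 2+c≤n) (cong (_+ 2) (sym σ≡splitSum))) l<bound)
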